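{- Let $q$ be an indeterminate and let $m,n,r\geq 0$ and $k\ge 0$ be integers. Then $$S_q^{(r)}(m+n,k)=\sum_{i=0}^n \sum_{j=0}^m q^{i(j+r)}[j+r]_q^{\,n-i}\binom{n}{i} S_q^{(r)}(m,j)\,S_q(i,k-j)$$ and $$B_q^{(r)}(m+n)=\sum_{i=0}^n \sum_{j=0}^m q^{i(j+r)}[j+r]_q^{\,n-i}\binom{n}{i} S_q^{(r)}(m,j)\, B_q(i).$$
   Context: For an integer $a\ge1$, $a_q=[a]_q=1+q+\cdots+q^{a-1}$, and $0_q=0$. A partition of $[n]=\{1,\dots,n\}$ is a set of nonempty disjoint blocks with union $[n]$. For a partition $\pi=B_1/B_2/\cdots/B_k$ of a finite set of positive integers written with $\min B_1<\min B_2<\cdots<\min B_k$, let $w(\pi)=\sum_{i=1}^k (i-1)|B_i|$. Let $S_q(n,k)=\sum_{\pi}q^{w(\pi)}$, summed over all partitions $\pi$ of $[n]$ into $k$ blocks (so $S_q(0,0)=1$, and $S_q(n,k)=0$ if $k>n$ or $k<0$), and $B_q(n)=\sum_{k=0}^n S_q(n,k)$. For $r\ge0$, let $\mathcal{P}^{(r)}_{n,k}$ be the set of partitions of $[n+r]$ into $k+r$ blocks in which $1,2,\dots,r$ lie in distinct blocks, and define $S_q^{(r)}(n,k)=\sum_{\pi\in\mathcal{P}^{(r)}_{n,k}}q^{w(\pi)}$ and $B_q^{(r)}(n)=\sum_{k=0}^n S_q^{(r)}(n,k)$. -}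

module Defs where

open import Level using (Level)
open import Data.Bool using (Bool; true; false; _∧_; not; if_then_else_)
open import Data.Nat using (ℕ; zero; suc; _+_; _∸_; _⊔_; _≡ᵇ_; _≤ᵇ_)
open import Data.Nat.Combinatorics using (_C_)
open import Data.List using (List; []; _∷_; map; concatMap; upTo; filter; foldr; take; reverse)
open import Data.Nat.ListAction using (sum)
open import Data.Bool.ListAction using (any)
open import Data.Product using (_×_; _,_; proj₁; proj₂)
open import Algebra.Bundles using (CommutativeSemiring)
import Algebra.Definitions.RawSemiring as RS

-- Restricted growth strings (RGS) encode set partitions of [n]:
-- a partition B_1/.../B_k (blocks ordered by minima) of [n] corresponds to
-- the word a_1 ... a_n with a_t = i - 1 iff t ∈ B_i.
-- rgsAll n lists every such word (stored REVERSED, i.e. a_n first),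
-- paired with its number of blocks k; each partition of [n] occurs once.
rgsAll : ℕ → List (List ℕ × ℕ)
rgsAll zero = ([] , 0) ∷ []
rgsAll (suc n) = concatMap step (rgsAll n)
  where
  step : List ℕ × ℕ → List (List ℕ × ℕ)
  step (s , b) = map (λ a → (a ∷ s , b ⊔ suc a)) (upTo (suc b))

word : List ℕ × ℕ → List ℕ
word p = reverse (proj₁ p)

nblocks : List ℕ × ℕ → ℕ
nblocks = proj₂

-- w(π) = Σ_i (i-1)|B_i| = Σ_t a_t
weight : List ℕ × ℕ → ℕ
weight p = sum (proj₁ p)

allDistinct : List ℕ → Bool
allDistinct [] = true
allDistinct (x ∷ xs) = not (any (λ y → x ≡ᵇ y) xs) ∧ allDistinct xs

module QStirling {c ℓ : Level} (R : CommutativeSemiring c ℓ) where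
  open CommutativeSemiring R using (Carrier; _≈_; 0#; rawSemiring) renaming (_+_ to _+ᴿ_; _*_ to _*ᴿ_)
  open RS rawSemiring using (_^_) renaming (_×_ to _times_)

  sumTo : ℕ → (ℕ → Carrier) → Carrier
  sumTo n f = foldr (λ i acc → f i +ᴿ acc) 0# (upTo (suc n))

  sumList : List Carrier → Carrier
  sumList = foldr _+ᴿ_ 0#

  qint : Carrier → ℕ → Carrier
  qint q a = foldr (λ t acc → q ^ t +ᴿ acc) 0# (upTo a)

  Sq : Carrier → ℕ → ℕ → Carrier
  Sq q n k = sumList (map (λ p → q ^ weight p)
               (filter (λ p → nblocks p Data.Nat.≟ k) (rgsAll n)))

  Bq : Carrier → ℕ → Carrier
  Bq q n = sumTo n (λ k → Sq q n k)

  Sqr : Carrier → ℕ → ℕ → ℕ → Carrier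
  Sqr q r n k = sumList (map (λ p → q ^ weight p)
                  (filter (λ p → Data.Bool._≟_ ((nblocks p ≡ᵇ (k + r)) ∧ allDistinct (take r (word p))) true)
                          (rgsAll (n + r))))

  Bqr : Carrier → ℕ → ℕ → Carrier
  Bqr q r n = sumTo n (λ k → Sqr q r n k)

  -- S_q(i, k - j) with integer subtraction: equals 0 when j > k
  SqDiff : Carrier → ℕ → ℕ → ℕ → Carrier
  SqDiff q i k j = if j ≤ᵇ k then Sq q i (k ∸ j) else 0#

  Carr : Set c
  Carr = Carrier

  infix 4 _≈ᴿ_
  _≈ᴿ_ : Carrier → Carrier → Set ℓ
  _≈ᴿ_ = _≈_

  infixl 6 _⊕_
  _⊕_ : Carrier → Carrier → Carrier
  _⊕_ = _+ᴿ_

  infixl 7 _⊗_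
  _⊗_ : Carrier → Carrier → Carrier
  _⊗_ = _*ᴿ_

  infixr 8 _^ᴿ_
  _^ᴿ_ : Carrier → ℕ → Carrier
  _^ᴿ_ = _^_

  infixr 7 _·ᴿ_
  _·ᴿ_ : ℕ → Carrier → Carrier
  _·ᴿ_ = _times_

module Submission where

-- Adding one element to set partitions acts on their q-weighted block-count distribution F
-- by the q-Stirling step F(K) ↦ [K]_q F(K) + q^(K-1) F(K-1): the element joins one of the K
-- blocks or opens a new one.  Hence the partitions of [m+n+r] arise from those of [m+r]
-- (first r elements in distinct blocks, s = j + r blocks) through a transfer kernel: the
-- solution of this recurrence in n that starts from the point mass at s.  The binomial sum
-- Σ_i C(n,i) q^(is) [s]_q^(n-i) S_q(i, K - s) starts there and, by Pascal's rule and the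
-- recurrence for S_q(i, ·), satisfies the same recurrence, so it is the kernel.  Summing
-- over k gives the Bell-number identity, as S_q(i, l) = 0 for l > i.

open import Defs
open import Level using (Level)
open import Function using (id; _∘_)
open import Function.Bundles using (Equivalence)
open import Data.Bool using (Bool; true; false; T; not; _∧_; if_then_else_)
import Data.Bool as Bool
open import Data.Bool.Properties using (T-∧; T-not-≡)
open import Data.Bool.ListAction using (any)
open import Data.Empty using (⊥-elim)
open import Data.Maybe using (nothing)
open import Data.Product using (_×_; _,_; proj₁; proj₂)
open import Data.Nat using (ℕ; zero; suc; _+_; _∸_; _*_; _≤_; _<_; z≤n; s≤s; _⊔_; _≡ᵇ_; _≤ᵇ_; _≟_)
open import Data.Nat.Properties
  using ( ≤-antisym; ≮⇒≥; ≰⇒>; ⊔-lub; m≤n⇒m≤1+n; ≤-trans; ≤-reflexive; ≤-pred; <-trans; <-≤-trans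
        ; <⇒≢; <⇒≱; m≤n⇒m⊔n≡n; m≥n⇒m⊔n≡m; n≤1+n; n<1+n; m≤m+n; m≤n+m; m≤n⇒∃[o]m+o≡n
        ; +-∸-assoc; +-suc; ≡⇒≡ᵇ; ≡ᵇ⇒≡; _≤?_; _<?_ )
import Data.Nat.Properties as ℕ
open import Data.Nat.ListAction using (sum)
open import Data.Nat.Combinatorics using (_C_; nCk+nC[k+1]≡[n+1]C[k+1]; k>n⇒nCk≡0)
open import Data.List
  using (List; []; _∷_; _++_; _∷ʳ_; map; concatMap; applyUpTo; upTo; foldr; filter; take; reverse; length)
open import Data.List.Properties using (unfold-reverse; applyUpTo-∷ʳ; length-reverse; take-all)
open import Data.List.Membership.Propositional using (_∈_; _∉_)
open import Data.List.Membership.Propositional.Properties using (∈-upTo⁺)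
open import Data.List.Relation.Unary.All as All using (All; []; _∷_)
open import Data.List.Relation.Unary.All.Properties using (concat⁺; map⁺; applyUpTo⁺₁)
open import Data.List.Relation.Unary.Any using (here; there)
open import Relation.Binary.PropositionalEquality as ≡ using (_≡_; _≢_)
open import Relation.Nullary using (does; yes; no)
open import Relation.Unary using (Decidable)
open import Algebra.Bundles using (CommutativeSemiring)
import Algebra.Definitions.RawSemiring as RS

module RestrictedGrowthStrings where
  open ≡ using (refl; sym; trans; cong; subst)

  take-∷ʳ : ∀ {A : Set} r (xs : List A) x → r ≤ length xs → take r (xs ∷ʳ x) ≡ take r xs
  take-∷ʳ zero    xs       x _         = refl
  take-∷ʳ (suc r) (y ∷ xs) x (s≤s r≤) = cong (y ∷_) (take-∷ʳ r xs x r≤)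

  any-∷ʳ : ∀ (p : ℕ → Bool) xs a →
    T (not (any p (xs ∷ʳ a))) → T (not (any p xs)) × T (not (p a))
  any-∷ʳ p [] a h with p a
  ... | false = _ , _
  ... | true  = ⊥-elim h
  any-∷ʳ p (x ∷ xs) a h with p x
  ... | false = any-∷ʳ p xs a h
  ... | true  = ⊥-elim h

  allDistinct-∷ʳ : ∀ xs a → T (allDistinct (xs ∷ʳ a)) → T (allDistinct xs) × a ∉ xs
  allDistinct-∷ʳ []       a _ = _ , λ ()
  allDistinct-∷ʳ (x ∷ xs) a d
    with x-fresh , xs∷ʳa-distinct ← Equivalence.to T-∧ d
    with x-fresh′ , x≢ᵇa ← any-∷ʳ (x ≡ᵇ_) xs a x-fresh
    with xs-distinct , a∉xs ← allDistinct-∷ʳ xs a xs∷ʳa-distinct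
    = Equivalence.from T-∧ (x-fresh′ , xs-distinct) , λ where
        (here refl)  → subst T (Equivalence.to T-not-≡ x≢ᵇa) (≡⇒≡ᵇ x x refl)
        (there a∈xs) → a∉xs a∈xs

  All-rgsAll : (P : ℕ → List ℕ × ℕ → Set) → P 0 ([] , 0) →
    (∀ {N s b a} → a ≤ b → P N (s , b) → P (suc N) (a ∷ s , b ⊔ suc a)) →
    ∀ N → All (P N) (rgsAll N)
  All-rgsAll P base extend zero    = base ∷ []
  All-rgsAll P base extend (suc N) =
    concat⁺ (map⁺ (All.map children (All-rgsAll P base extend N)))
    where
    children : ∀ {p} → P N p →
      All (P (suc N)) (map (λ a → (a ∷ proj₁ p , proj₂ p ⊔ suc a)) (upTo (suc (proj₂ p))))
    children Pp = map⁺ (applyUpTo⁺₁ id _ (λ { (s≤s a≤b) → extend a≤b Pp }))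

  rgsAll-length : ∀ N → All (λ p → length (proj₁ p) ≡ N) (rgsAll N)
  rgsAll-length = All-rgsAll (λ N p → length (proj₁ p) ≡ N) refl (λ _ → cong suc)

  rgsAll-nblocks≤ : ∀ N → All (λ p → nblocks p ≤ N) (rgsAll N)
  rgsAll-nblocks≤ = All-rgsAll (λ N p → nblocks p ≤ N) z≤n
    (λ a≤b b≤N → ⊔-lub (m≤n⇒m≤1+n b≤N) (s≤s (≤-trans a≤b b≤N)))

  rgsAll-allDistinct : ∀ N →
    All (λ p → T (allDistinct (word p)) → nblocks p ≡ N × word p ≡ upTo N) (rgsAll N)
  rgsAll-allDistinct = All-rgsAll (λ N p → T (allDistinct (word p)) → nblocks p ≡ N × word p ≡ upTo N)
    (λ _ → refl , refl) (λ {N} {s} → extend {N} {s})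
    where
    extend : ∀ {N s b a} → a ≤ b →
      (T (allDistinct (reverse s)) → b ≡ N × reverse s ≡ upTo N) →
      T (allDistinct (reverse (a ∷ s))) → b ⊔ suc a ≡ suc N × reverse (a ∷ s) ≡ upTo (suc N)
    extend {N} {s} {b} {a} a≤b ih d
      with s-distinct , a∉s ←
             allDistinct-∷ʳ (reverse s) a (subst (T ∘ allDistinct) (unfold-reverse a s) d)
      with refl , s≡upTo ← ih s-distinct
      with refl ← ≤-antisym a≤b (≮⇒≥ (λ a<N → a∉s (subst (a ∈_) (sym s≡upTo) (∈-upTo⁺ a<N))))
      = m≤n⇒m⊔n≡n (n≤1+n a)
      , trans (unfold-reverse a s) (trans (cong (_∷ʳ a) s≡upTo) (applyUpTo-∷ʳ id a))

open RestrictedGrowthStrings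

module FiniteSums {c ℓ : Level} (R : CommutativeSemiring c ℓ) where
  open CommutativeSemiring R renaming (_+_ to _⊕_; _*_ to _⊗_)
  open import Relation.Binary.Reasoning.Setoid setoid
  open import Algebra.Properties.CommutativeSemigroup +-commutativeSemigroup using (interchange)

  Σ : ℕ → (ℕ → Carrier) → Carrier
  Σ zero    f = 0#
  Σ (suc n) f = f 0 ⊕ Σ n (λ i → f (suc i))

  Σ-cong< : ∀ n {f g} → (∀ i → i < n → f i ≈ g i) → Σ n f ≈ Σ n g
  Σ-cong< zero    f≈g = refl
  Σ-cong< (suc n) f≈g = +-cong (f≈g 0 (s≤s z≤n)) (Σ-cong< n (λ i i<n → f≈g (suc i) (s≤s i<n)))

  Σ-cong : ∀ n {f g} → (∀ i → f i ≈ g i) → Σ n f ≈ Σ n g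
  Σ-cong n f≈g = Σ-cong< n (λ i _ → f≈g i)

  Σ-zero : ∀ n {f} → (∀ i → i < n → f i ≈ 0#) → Σ n f ≈ 0#
  Σ-zero zero    f≈0 = refl
  Σ-zero (suc n) f≈0 =
    trans (+-cong (f≈0 0 (s≤s z≤n)) (Σ-zero n (λ i i<n → f≈0 (suc i) (s≤s i<n)))) (+-identityʳ 0#)

  Σ-+ : ∀ n f g → Σ n (λ i → f i ⊕ g i) ≈ Σ n f ⊕ Σ n g
  Σ-+ zero    f g = sym (+-identityʳ 0#)
  Σ-+ (suc n) f g = trans (+-congˡ (Σ-+ n _ _)) (interchange _ _ _ _)

  Σ-distribˡ : ∀ n a f → a ⊗ Σ n f ≈ Σ n (λ i → a ⊗ f i)
  Σ-distribˡ zero    a f = zeroʳ a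
  Σ-distribˡ (suc n) a f = trans (distribˡ a _ _) (+-congˡ (Σ-distribˡ n a _))

  Σ-distribʳ : ∀ n a f → Σ n f ⊗ a ≈ Σ n (λ i → f i ⊗ a)
  Σ-distribʳ n a f = trans (*-comm _ a) (trans (Σ-distribˡ n a f) (Σ-cong n (λ i → *-comm a (f i))))

  Σ-suc : ∀ n f → Σ (suc n) f ≈ Σ n f ⊕ f n
  Σ-suc zero    f = trans (+-identityʳ _) (sym (+-identityˡ _))
  Σ-suc (suc n) f = trans (+-congˡ (Σ-suc n _)) (sym (+-assoc _ _ _))

  Σ-split : ∀ a b f → Σ (a + b) f ≈ Σ a f ⊕ Σ b (λ i → f (a + i))
  Σ-split zero    b f = sym (+-identityˡ _)
  Σ-split (suc a) b f = trans (+-congˡ (Σ-split a b _)) (sym (+-assoc _ _ _))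

  Σ-swap : ∀ n m (f : ℕ → ℕ → Carrier) →
    Σ n (λ i → Σ m (λ j → f i j)) ≈ Σ m (λ j → Σ n (λ i → f i j))
  Σ-swap zero    m f = sym (Σ-zero m (λ _ _ → refl))
  Σ-swap (suc n) m f = trans (+-congˡ (Σ-swap n m _)) (sym (Σ-+ m _ _))

  Σ-truncate : ∀ {n L f} → n ≤ L → (∀ t → n ≤ t → f t ≈ 0#) → Σ L f ≈ Σ n f
  Σ-truncate {n} {L} {f} n≤L f≈0 with d , ≡.refl ← m≤n⇒∃[o]m+o≡n n≤L = begin
    Σ (n + d) f                        ≈⟨ Σ-split n d f ⟩
    Σ n f ⊕ Σ d (λ i → f (n + i))      ≈⟨ +-congˡ (Σ-zero d (λ i _ → f≈0 (n + i) (m≤m+n n i))) ⟩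
    Σ n f ⊕ 0#                         ≈⟨ +-identityʳ _ ⟩
    Σ n f                              ∎

  sumBy : {A : Set} → (A → Carrier) → List A → Carrier
  sumBy h = foldr (λ x acc → h x ⊕ acc) 0#

  sumBy-applyUpTo : {A : Set} (h : A → Carrier) (g : ℕ → A) (n : ℕ) →
    sumBy h (applyUpTo g n) ≡ Σ n (λ i → h (g i))
  sumBy-applyUpTo h g zero    = ≡.refl
  sumBy-applyUpTo h g (suc n) = ≡.cong (h (g 0) ⊕_) (sumBy-applyUpTo h (g ∘ suc) n)

  sumBy-map : {A B : Set} (h : B → Carrier) (f : A → B) (xs : List A) →
    sumBy h (map f xs) ≡ sumBy (h ∘ f) xs
  sumBy-map h f []       = ≡.refl
  sumBy-map h f (x ∷ xs) = ≡.cong (h (f x) ⊕_) (sumBy-map h f xs)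

  sumBy-++ : {A : Set} (h : A → Carrier) (xs ys : List A) → sumBy h (xs ++ ys) ≈ sumBy h xs ⊕ sumBy h ys
  sumBy-++ h []       ys = sym (+-identityˡ _)
  sumBy-++ h (x ∷ xs) ys = trans (+-congˡ (sumBy-++ h xs ys)) (sym (+-assoc _ _ _))

  sumBy-concatMap : {A B : Set} (h : B → Carrier) (f : A → List B) (xs : List A) →
    sumBy h (concatMap f xs) ≈ sumBy (λ x → sumBy h (f x)) xs
  sumBy-concatMap h f []       = refl
  sumBy-concatMap h f (x ∷ xs) = trans (sumBy-++ h (f x) (concatMap f xs)) (+-congˡ (sumBy-concatMap h f xs))

  sumBy-congAll : {A : Set} {h h′ : A → Carrier} (xs : List A) →
    All (λ x → h x ≈ h′ x) xs → sumBy h xs ≈ sumBy h′ xs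
  sumBy-congAll []       []           = refl
  sumBy-congAll (x ∷ xs) (hx≈ ∷ hxs≈) = +-cong hx≈ (sumBy-congAll xs hxs≈)

  sumBy-zero : {A : Set} {h : A → Carrier} (xs : List A) →
    All (λ x → h x ≈ 0#) xs → sumBy h xs ≈ 0#
  sumBy-zero []       []           = refl
  sumBy-zero (x ∷ xs) (hx≈0 ∷ hxs≈0) = trans (+-cong hx≈0 (sumBy-zero xs hxs≈0)) (+-identityʳ 0#)

  sumList-filter : {A : Set} {P : A → Set} (P? : Decidable P) (g : A → Carrier) (xs : List A) →
    QStirling.sumList R (map g (filter P? xs)) ≈ sumBy (λ x → if does (P? x) then g x else 0#) xs
  sumList-filter P? g []       = refl
  sumList-filter P? g (x ∷ xs) with does (P? x)
  ... | true  = +-congˡ (sumList-filter P? g xs)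
  ... | false = trans (sumList-filter P? g xs) (sym (+-identityˡ _))

module BinomialSums {c ℓ : Level} (R : CommutativeSemiring c ℓ) where
  open CommutativeSemiring R renaming (_+_ to _⊕_; _*_ to _⊗_)
  open RS rawSemiring using (_^_) renaming (_×_ to _·_)
  open import Relation.Binary.Reasoning.Setoid setoid
  open import Algebra.Properties.Semiring.Mult semiring using (×-congʳ; ×-assoc-*; ×-homo-+; ×-homo-1)
  open import Algebra.Solver.Ring.NaturalCoefficients R (λ _ _ → nothing)
    using (solve; _:=_; _:+_; _:*_; con)
  open import Algebra.Properties.CommutativeSemigroup *-commutativeSemigroup using (x∙yz≈y∙xz)
  open FiniteSums R

  binomialTerm : Carrier → Carrier → ℕ → (ℕ → Carrier) → ℕ → Carrier
  binomialTerm x y n u i = y ^ i ⊗ x ^ (n ∸ i) ⊗ ((n C i) · u i)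

  binomialSum : Carrier → Carrier → ℕ → (ℕ → Carrier) → Carrier
  binomialSum x y n u = Σ (suc n) (binomialTerm x y n u)

  private
    binomialTerm-linear : ∀ x y n u i →
      binomialTerm x y n u i ≈ (y ^ i ⊗ x ^ (n ∸ i) ⊗ ((n C i) · 1#)) ⊗ u i
    binomialTerm-linear x y n u i =
      trans (*-congˡ (trans (×-congʳ (n C i) (sym (*-identityˡ (u i))))
                            (sym (×-assoc-* (n C i) 1# (u i)))))
            (sym (*-assoc _ _ _))

  binomialSum-zero : ∀ x y u → binomialSum x y 0 u ≈ u 0
  binomialSum-zero x y u =
    trans (+-identityʳ _) (trans (*-cong (*-identityˡ 1#) (×-homo-1 (u 0))) (*-identityˡ _))

  binomialSum-cong< : ∀ x y n {u v} → (∀ i → i ≤ n → u i ≈ v i) →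
    binomialSum x y n u ≈ binomialSum x y n v
  binomialSum-cong< x y n {u} {v} u≈v = Σ-cong< (suc n) {binomialTerm x y n u} {binomialTerm x y n v}
    (λ i i<1+n → *-congˡ (×-congʳ (n C i) (u≈v i (≤-pred i<1+n))))

  binomialSum-0# : ∀ x y n → binomialSum x y n (λ _ → 0#) ≈ 0#
  binomialSum-0# x y n =
    Σ-zero (suc n) (λ i _ → trans (binomialTerm-linear x y n (λ _ → 0#) i) (zeroʳ _))

  binomialSum-+ : ∀ x y n u v →
    binomialSum x y n (λ i → u i ⊕ v i) ≈ binomialSum x y n u ⊕ binomialSum x y n v
  binomialSum-+ x y n u v =
    trans (Σ-cong (suc n) split) (Σ-+ (suc n) (binomialTerm x y n u) (binomialTerm x y n v))
    where
    split : ∀ i →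
      binomialTerm x y n (λ i → u i ⊕ v i) i ≈ binomialTerm x y n u i ⊕ binomialTerm x y n v i
    split i = trans (binomialTerm-linear x y n (λ i → u i ⊕ v i) i)
      (trans (distribˡ _ _ _) (sym (+-cong (binomialTerm-linear x y n u i) (binomialTerm-linear x y n v i))))

  binomialSum-*ˡ : ∀ x y n a u → binomialSum x y n (λ i → a ⊗ u i) ≈ a ⊗ binomialSum x y n u
  binomialSum-*ˡ x y n a u =
    trans (Σ-cong (suc n) pull) (sym (Σ-distribˡ (suc n) a (binomialTerm x y n u)))
    where
    pull : ∀ i → binomialTerm x y n (λ i → a ⊗ u i) i ≈ a ⊗ binomialTerm x y n u i
    pull i = trans (binomialTerm-linear x y n (λ i → a ⊗ u i) i)
      (trans (x∙yz≈y∙xz _ a _) (*-congˡ (sym (binomialTerm-linear x y n u i))))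

  binomialSum-Σ : ∀ x y n K (u : ℕ → ℕ → Carrier) →
    binomialSum x y n (λ i → Σ K (λ k → u k i)) ≈ Σ K (λ k → binomialSum x y n (u k))
  binomialSum-Σ x y n zero    u = binomialSum-0# x y n
  binomialSum-Σ x y n (suc K) u =
    trans (binomialSum-+ x y n (u 0) (λ i → Σ K (λ k → u (suc k) i)))
          (+-congˡ (binomialSum-Σ x y n K (u ∘ suc)))

  -- Pascal's rule C(n+1, i+1) = C(n, i) + C(n, i+1).
  binomialSum-suc : ∀ x y n u →
    binomialSum x y (suc n) u ≈ x ⊗ binomialSum x y n u ⊕ y ⊗ binomialSum x y n (u ∘ suc)
  binomialSum-suc x y n u = begin
    t′ 0 ⊕ Σ (suc n) (λ i → t′ (suc i))
      ≈⟨ +-congˡ (Σ-cong (suc n) pascal) ⟩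
    t′ 0 ⊕ Σ (suc n) (λ i → y ⊗ binomialTerm x y n (u ∘ suc) i ⊕ h i)
      ≈⟨ +-congˡ (Σ-+ (suc n) (λ i → y ⊗ binomialTerm x y n (u ∘ suc) i) h) ⟩
    t′ 0 ⊕ (Σ (suc n) (λ i → y ⊗ binomialTerm x y n (u ∘ suc) i) ⊕ Σ (suc n) h)
      ≈⟨ +-congˡ (+-cong (sym (Σ-distribˡ (suc n) y (binomialTerm x y n (u ∘ suc)))) (Σ-suc n h)) ⟩
    t′ 0 ⊕ (y ⊗ B′ ⊕ (Σ n h ⊕ h n))
      ≈⟨ +-congˡ (+-congˡ (trans (+-cong (Σ-cong< n h≈x⊗t) h-last) (+-identityʳ _))) ⟩
    t′ 0 ⊕ (y ⊗ B′ ⊕ Σ n (λ i → x ⊗ t (suc i)))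
      ≈⟨ +-congˡ (+-congˡ (sym (Σ-distribˡ n x (t ∘ suc)))) ⟩
    t′ 0 ⊕ (y ⊗ B′ ⊕ x ⊗ Σ n (t ∘ suc))
      ≈⟨ solve 6 (λ X Y Xⁿ U₀ B T → (con 1 :* (X :* Xⁿ)) :* U₀ :+ (Y :* B :+ X :* T)
                                   := X :* (con 1 :* Xⁿ :* U₀ :+ T) :+ Y :* B)
           refl x y (x ^ n) (1 · u 0) B′ (Σ n (t ∘ suc)) ⟩
    x ⊗ binomialSum x y n u ⊕ y ⊗ B′ ∎
    where
    t′ t : ℕ → Carrier
    t′ = binomialTerm x y (suc n) u
    t  = binomialTerm x y n u
    B′ : Carrier
    B′ = binomialSum x y n (u ∘ suc)
    h : ℕ → Carrier
    h i = y ^ suc i ⊗ x ^ (n ∸ i) ⊗ ((n C suc i) · u (suc i))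
    pascal : ∀ i → t′ (suc i) ≈ y ⊗ binomialTerm x y n (u ∘ suc) i ⊕ h i
    pascal i rewrite ≡.sym (nCk+nC[k+1]≡[n+1]C[k+1] n i) =
      trans (*-congˡ (×-homo-+ (u (suc i)) (n C i) (n C suc i)))
        (solve 5 (λ Y Yⁱ X A B → (Y :* Yⁱ) :* X :* (A :+ B)
                              := Y :* (Yⁱ :* X :* A) :+ (Y :* Yⁱ) :* X :* B)
          refl y (y ^ i) (x ^ (n ∸ i)) ((n C i) · u (suc i)) ((n C suc i) · u (suc i)))
    h≈x⊗t : ∀ i → i < n → h i ≈ x ⊗ t (suc i)
    h≈x⊗t i i<n rewrite +-∸-assoc 1 i<n =
      solve 4 (λ Yⁱ X Xᵏ C → Yⁱ :* (X :* Xᵏ) :* C := X :* (Yⁱ :* Xᵏ :* C)) refl _ _ _ _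
    h-last : h n ≈ 0#
    h-last rewrite k>n⇒nCk≡0 (n<1+n n) = zeroʳ _

module QStirlingRecurrence {c ℓ : Level} (R : CommutativeSemiring c ℓ)
                           (q : CommutativeSemiring.Carrier R) where
  open CommutativeSemiring R renaming (_+_ to _⊕_; _*_ to _⊗_)
  open RS rawSemiring using (_^_) renaming (_×_ to _·_)
  open QStirling R using (sumTo; qint; Sq; Sqr; Bq; Bqr; SqDiff)
  open import Relation.Binary.Reasoning.Setoid setoid
  open import Algebra.Properties.Semiring.Exp semiring using (^-homo-*; ^-assocʳ)
  open import Algebra.Solver.Ring.NaturalCoefficients R (λ _ _ → nothing)
    using (solve; _:=_; _:+_; _:*_)
  open import Algebra.Properties.CommutativeSemigroup +-commutativeSemigroup using (interchange)
  open import Algebra.Properties.CommutativeSemigroup *-commutativeSemigroup using (x∙yz≈y∙xz)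
  open FiniteSums R
  open BinomialSums R

  sumTo≡Σ : ∀ n f → sumTo n f ≡ Σ (suc n) f
  sumTo≡Σ n f = sumBy-applyUpTo f id (suc n)

  qint≡Σ : ∀ a → qint q a ≡ Σ a (q ^_)
  qint≡Σ = sumBy-applyUpTo (q ^_) id

  qint-+ : ∀ a b → qint q (a + b) ≈ qint q a ⊕ q ^ a ⊗ qint q b
  qint-+ a b = begin
    qint q (a + b)                           ≡⟨ qint≡Σ (a + b) ⟩
    Σ (a + b) (q ^_)                         ≈⟨ Σ-split a b (q ^_) ⟩
    Σ a (q ^_) ⊕ Σ b (λ i → q ^ (a + i))     ≈⟨ +-congˡ (Σ-cong b (^-homo-* q a)) ⟩
    Σ a (q ^_) ⊕ Σ b (λ i → q ^ a ⊗ q ^ i)   ≈⟨ +-congˡ (sym (Σ-distribˡ b (q ^ a) (q ^_))) ⟩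
    Σ a (q ^_) ⊕ q ^ a ⊗ Σ b (q ^_)
      ≡⟨ ≡.sym (≡.cong₂ (λ u v → u ⊕ q ^ a ⊗ v) (qint≡Σ a) (qint≡Σ b)) ⟩
    qint q a ⊕ q ^ a ⊗ qint q b              ∎

  openBlock : (ℕ → Carrier) → ℕ → Carrier
  openBlock f zero    = 0#
  openBlock f (suc K) = q ^ K ⊗ f K

  -- S_q(n+1, K) = [K]_q S_q(n, K) + q^(K-1) S_q(n, K-1)
  qStirlingStep : (ℕ → Carrier) → ℕ → Carrier
  qStirlingStep f K = qint q K ⊗ f K ⊕ openBlock f K

  openBlock-cong : ∀ {f g} → (∀ K → f K ≈ g K) → ∀ K → openBlock f K ≈ openBlock g K
  openBlock-cong f≈g zero    = refl
  openBlock-cong f≈g (suc K) = *-congˡ (f≈g K)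

  openBlock-+ : ∀ f g K → openBlock (λ K → f K ⊕ g K) K ≈ openBlock f K ⊕ openBlock g K
  openBlock-+ f g zero    = sym (+-identityʳ 0#)
  openBlock-+ f g (suc K) = distribˡ _ _ _

  openBlock-*ˡ : ∀ a f K → openBlock (λ K → a ⊗ f K) K ≈ a ⊗ openBlock f K
  openBlock-*ˡ a f zero    = sym (zeroʳ a)
  openBlock-*ˡ a f (suc K) = x∙yz≈y∙xz _ a _

  qStirlingStep-cong : ∀ {f g} → (∀ K → f K ≈ g K) → ∀ K → qStirlingStep f K ≈ qStirlingStep g K
  qStirlingStep-cong f≈g K = +-cong (*-congˡ (f≈g K)) (openBlock-cong f≈g K)

  qStirlingStep-+ : ∀ f g K →
    qStirlingStep (λ K → f K ⊕ g K) K ≈ qStirlingStep f K ⊕ qStirlingStep g K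
  qStirlingStep-+ f g K = trans (+-cong (distribˡ _ _ _) (openBlock-+ f g K)) (interchange _ _ _ _)

  qStirlingStep-*ˡ : ∀ a f K → qStirlingStep (λ K → a ⊗ f K) K ≈ a ⊗ qStirlingStep f K
  qStirlingStep-*ˡ a f K = trans (+-cong (x∙yz≈y∙xz _ a _) (openBlock-*ˡ a f K)) (sym (distribˡ a _ _))

  qStirlingStep-vanishes : ∀ r {f} → (∀ K → K < r → f K ≈ 0#) →
    ∀ K → K < r → qStirlingStep f K ≈ 0#
  qStirlingStep-vanishes r {f} f≈0 K K<r =
    trans (+-cong (trans (*-congˡ (f≈0 K K<r)) (zeroʳ _)) (openBlock≈0 K K<r)) (+-identityʳ 0#)
    where
    openBlock≈0 : ∀ K → K < r → openBlock f K ≈ 0#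
    openBlock≈0 zero    _    = refl
    openBlock≈0 (suc K) K<r′ = trans (*-congˡ (f≈0 K (<-trans (n<1+n K) K<r′))) (zeroʳ _)

  qStirlingStep-0# : ∀ K → qStirlingStep (λ _ → 0#) K ≈ 0#
  qStirlingStep-0# K = qStirlingStep-vanishes (suc K) (λ _ _ → refl) K (n<1+n K)

  qStirlingStep-Σ : ∀ n (F : ℕ → ℕ → Carrier) K →
    qStirlingStep (λ K → Σ n (λ J → F J K)) K ≈ Σ n (λ J → qStirlingStep (F J) K)
  qStirlingStep-Σ zero    F K = qStirlingStep-0# K
  qStirlingStep-Σ (suc n) F K =
    trans (qStirlingStep-+ (F 0) (λ K → Σ n (λ J → F (suc J) K)) K)
          (+-congˡ (qStirlingStep-Σ n (F ∘ suc) K))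

  qStirlingStep-sumBy : {A : Set} (F : A → ℕ → Carrier) (xs : List A) (K : ℕ) →
    qStirlingStep (λ K → sumBy (λ x → F x K) xs) K ≈ sumBy (λ x → qStirlingStep (F x) K) xs
  qStirlingStep-sumBy F []       K = qStirlingStep-0# K
  qStirlingStep-sumBy F (x ∷ xs) K =
    trans (qStirlingStep-+ (F x) (λ K → sumBy (λ x → F x K) xs) K)
          (+-congˡ (qStirlingStep-sumBy F xs K))

  Solves : (ℕ → ℕ → Carrier) → Set ℓ
  Solves F = ∀ n K → F (suc n) K ≈ qStirlingStep (F n) K

  solutions-unique : ∀ {F G} → Solves F → Solves G →
    (∀ K → F 0 K ≈ G 0 K) → ∀ n K → F n K ≈ G n K
  solutions-unique F-solves G-solves F₀≈G₀ zero    K = F₀≈G₀ K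
  solutions-unique F-solves G-solves F₀≈G₀ (suc n) K =
    trans (F-solves n K)
      (trans (qStirlingStep-cong (solutions-unique F-solves G-solves F₀≈G₀ n) K) (sym (G-solves n K)))

  Solves-Σ : ∀ N (a : ℕ → Carrier) {T : ℕ → ℕ → ℕ → Carrier} → (∀ J → Solves (T J)) →
    Solves (λ n K → Σ N (λ J → a J ⊗ T J n K))
  Solves-Σ N a {T} T-solves n K = begin
    Σ N (λ J → a J ⊗ T J (suc n) K)
      ≈⟨ Σ-cong N (λ J → *-congˡ (T-solves J n K)) ⟩
    Σ N (λ J → a J ⊗ qStirlingStep (T J n) K)
      ≈⟨ Σ-cong N (λ J → sym (qStirlingStep-*ˡ (a J) (T J n) K)) ⟩
    Σ N (λ J → qStirlingStep (λ K → a J ⊗ T J n K) K)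
      ≈⟨ sym (qStirlingStep-Σ N (λ J K → a J ⊗ T J n K) K) ⟩
    qStirlingStep (λ K → Σ N (λ J → a J ⊗ T J n K)) K ∎

  pointMass : ℕ → Carrier → ℕ → Carrier
  pointMass b h K = if b ≡ᵇ K then h else 0#

  private
    ≡ᵇ-true : ∀ {b K} → (b ≡ᵇ K) ≡ true → b ≡ K
    ≡ᵇ-true {b} {K} eq = ≡ᵇ⇒≡ b K (≡.subst T (≡.sym eq) _)

  pointMass-≢ : ∀ {b K} h → b ≢ K → pointMass b h K ≡ 0#
  pointMass-≢ {b} {K} h b≢K with b ≡ᵇ K in eq
  ... | false = ≡.refl
  ... | true  = ⊥-elim (b≢K (≡ᵇ-true eq))

  pointMass-0# : ∀ b K → pointMass b 0# K ≡ 0#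
  pointMass-0# b K with b ≡ᵇ K
  ... | false = ≡.refl
  ... | true  = ≡.refl

  pointMass-cong : ∀ b K {h h′} → h ≈ h′ → pointMass b h K ≈ pointMass b h′ K
  pointMass-cong b K h≈h′ with b ≡ᵇ K
  ... | false = refl
  ... | true  = h≈h′

  pointMass-pull : ∀ (f : ℕ → Carrier) b h K → pointMass b (f b ⊗ h) K ≈ f K ⊗ pointMass b h K
  pointMass-pull f b h K with b ≡ᵇ K in eq
  ... | false = sym (zeroʳ _)
  ... | true with ≡.refl ← ≡ᵇ-true {b} {K} eq = refl

  pointMass-Σ : ∀ n b (g : ℕ → Carrier) K →
    Σ n (λ a → pointMass b (g a) K) ≈ pointMass b (Σ n g) K
  pointMass-Σ n b g K with b ≡ᵇ K
  ... | false = Σ-zero n (λ _ _ → refl)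
  ... | true  = refl

  -- Element N+1 joins block a < b (weight a, still b blocks) or opens block b (weight b).
  pointMass-step : ∀ b h K →
    Σ (suc b) (λ a → pointMass (b ⊔ suc a) (q ^ a ⊗ h) K) ≈ qStirlingStep (pointMass b h) K
  pointMass-step b h K = begin
    Σ (suc b) (λ a → pointMass (b ⊔ suc a) (q ^ a ⊗ h) K)
      ≈⟨ Σ-suc b (λ a → pointMass (b ⊔ suc a) (q ^ a ⊗ h) K) ⟩
    Σ b (λ a → pointMass (b ⊔ suc a) (q ^ a ⊗ h) K) ⊕ pointMass (b ⊔ suc b) (q ^ b ⊗ h) K
      ≈⟨ +-cong (Σ-cong< b (λ a a<b → reflexive (≡.cong (λ c → pointMass c (q ^ a ⊗ h) K)
                                                         (m≥n⇒m⊔n≡m a<b))))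
                (reflexive (≡.cong (λ c → pointMass c (q ^ b ⊗ h) K) (m≤n⇒m⊔n≡n (n≤1+n b)))) ⟩
    Σ b (λ a → pointMass b (q ^ a ⊗ h) K) ⊕ pointMass (suc b) (q ^ b ⊗ h) K
      ≈⟨ +-cong joinBlock (openNewBlock K) ⟩
    qint q K ⊗ pointMass b h K ⊕ openBlock (pointMass b h) K ∎
    where
    joinBlock : Σ b (λ a → pointMass b (q ^ a ⊗ h) K) ≈ qint q K ⊗ pointMass b h K
    joinBlock = begin
      Σ b (λ a → pointMass b (q ^ a ⊗ h) K) ≈⟨ pointMass-Σ b b (λ a → q ^ a ⊗ h) K ⟩
      pointMass b (Σ b (λ a → q ^ a ⊗ h)) K
        ≈⟨ pointMass-cong b K (sym (trans (*-congʳ (reflexive (qint≡Σ b))) (Σ-distribʳ b h (q ^_)))) ⟩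
      pointMass b (qint q b ⊗ h) K          ≈⟨ pointMass-pull (qint q) b h K ⟩
      qint q K ⊗ pointMass b h K            ∎
    openNewBlock : ∀ K → pointMass (suc b) (q ^ b ⊗ h) K ≈ openBlock (pointMass b h) K
    openNewBlock zero    = refl
    openNewBlock (suc K) = pointMass-pull (q ^_) b h K

  Σ-pointMass : ∀ n K (f : ℕ → Carrier) → K < n → Σ n (λ J → f J ⊗ pointMass J 1# K) ≈ f K
  Σ-pointMass (suc n) zero    f _ =
    trans (+-cong (*-identityʳ (f 0)) (Σ-zero n (λ J _ → zeroʳ (f (suc J))))) (+-identityʳ _)
  Σ-pointMass (suc n) (suc K) f (s≤s K<n) =
    trans (+-cong (zeroʳ (f 0)) (Σ-pointMass n K (f ∘ suc) K<n)) (+-identityˡ _)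

  Σ-pointMass-≥ : ∀ n K (f : ℕ → Carrier) → n ≤ K →
    Σ n (λ J → f J ⊗ pointMass J 1# K) ≈ 0#
  Σ-pointMass-≥ n K f n≤K =
    Σ-zero n (λ J J<n →
      trans (*-congˡ (reflexive (pointMass-≢ 1# (<⇒≢ (<-≤-trans J<n n≤K))))) (zeroʳ _))

  distinctPrefix : ℕ → List ℕ × ℕ → Bool
  distinctPrefix r p = allDistinct (take r (word p))

  prefixWeight : ℕ → List ℕ × ℕ → Carrier
  prefixWeight r p = if distinctPrefix r p then q ^ weight p else 0#

  partitionSum : ℕ → ℕ → ℕ → Carrier
  partitionSum N r K = sumBy (λ p → pointMass (nblocks p) (prefixWeight r p) K) (rgsAll N)

  Sq≈partitionSum : ∀ n k → Sq q n k ≈ partitionSum n 0 k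
  Sq≈partitionSum n k = sumList-filter (λ p → nblocks p ≟ k) (λ p → q ^ weight p) (rgsAll n)

  Sqr≈partitionSum : ∀ r n k → Sqr q r n k ≈ partitionSum (n + r) r (k + r)
  Sqr≈partitionSum r n k =
    trans (sumList-filter (λ p → ((nblocks p ≡ᵇ (k + r)) ∧ distinctPrefix r p) Bool.≟ true)
                          (λ p → q ^ weight p) (rgsAll (n + r)))
          (sumBy-congAll (rgsAll (n + r))
            (All.universal (λ p → reflexive (if-∧ (nblocks p ≡ᵇ (k + r)) (distinctPrefix r p))) _))
    where
    if-∧ : ∀ a b {x} →
      (if does ((a ∧ b) Bool.≟ true) then x else 0#) ≡ (if a then (if b then x else 0#) else 0#)
    if-∧ true  true  = ≡.refl
    if-∧ true  false = ≡.refl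
    if-∧ false b     = ≡.refl

  distinctPrefix-child : ∀ r s b a c → r ≤ length s →
    distinctPrefix r (a ∷ s , c) ≡ distinctPrefix r (s , b)
  distinctPrefix-child r s b a c r≤|s| =
    ≡.cong allDistinct (≡.trans (≡.cong (take r) (unfold-reverse a s))
      (take-∷ʳ r (reverse s) a (≡.subst (r ≤_) (≡.sym (length-reverse s)) r≤|s|)))

  prefixWeight-child : ∀ r s b a c → r ≤ length s →
    prefixWeight r (a ∷ s , c) ≈ q ^ a ⊗ prefixWeight r (s , b)
  prefixWeight-child r s b a c r≤|s|
    with distinctPrefix r (a ∷ s , c) | distinctPrefix-child r s b a c r≤|s|
  ... | _ | ≡.refl with distinctPrefix r (s , b)
  ...   | true  = ^-homo-* q a (sum s)
  ...   | false = sym (zeroʳ _)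

  partitionSum-suc : ∀ {N r} → r ≤ N → ∀ K →
    partitionSum (suc N) r K ≈ qStirlingStep (partitionSum N r) K
  partitionSum-suc {N} {r} r≤N K = begin
    partitionSum (suc N) r K
      ≈⟨ sumBy-concatMap (summand K) _ (rgsAll N) ⟩
    sumBy (λ p → sumBy (summand K) (children p)) (rgsAll N)
      ≈⟨ sumBy-congAll (rgsAll N)
           (All.map (λ {p} |p|≡N → childrenSum p (≤-trans r≤N (≤-reflexive (≡.sym |p|≡N))))
                    (rgsAll-length N)) ⟩
    sumBy (λ p → qStirlingStep (λ K → summand K p) K) (rgsAll N)
      ≈⟨ sym (qStirlingStep-sumBy (λ p K → summand K p) (rgsAll N) K) ⟩
    qStirlingStep (partitionSum N r) K ∎
    where
    summand : ℕ → List ℕ × ℕ → Carrier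
    summand K p = pointMass (nblocks p) (prefixWeight r p) K
    children : List ℕ × ℕ → List (List ℕ × ℕ)
    children (s , b) = map (λ a → (a ∷ s , b ⊔ suc a)) (upTo (suc b))
    childrenSum : ∀ p → r ≤ length (proj₁ p) →
      sumBy (summand K) (children p) ≈ qStirlingStep (λ K → summand K p) K
    childrenSum (s , b) r≤|s| = begin
      sumBy (summand K) (children (s , b))
        ≡⟨ ≡.trans (sumBy-map (summand K) _ (upTo (suc b))) (sumBy-applyUpTo _ id (suc b)) ⟩
      Σ (suc b) (λ a → pointMass (b ⊔ suc a) (prefixWeight r (a ∷ s , b ⊔ suc a)) K)
        ≈⟨ Σ-cong (suc b) (λ a →
             pointMass-cong (b ⊔ suc a) K (prefixWeight-child r s b a (b ⊔ suc a) r≤|s|)) ⟩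
      Σ (suc b) (λ a → pointMass (b ⊔ suc a) (q ^ a ⊗ prefixWeight r (s , b)) K)
        ≈⟨ pointMass-step b (prefixWeight r (s , b)) K ⟩
      qStirlingStep (λ K → summand K (s , b)) K ∎

  partitionSum-> : ∀ {N K} r → N < K → partitionSum N r K ≈ 0#
  partitionSum-> {N} {K} r N<K = sumBy-zero (rgsAll N) (All.map (λ {p} → vanish {p}) (rgsAll-nblocks≤ N))
    where
    vanish : ∀ {p} → nblocks p ≤ N → pointMass (nblocks p) (prefixWeight r p) K ≈ 0#
    vanish b≤N = reflexive (pointMass-≢ _ (λ b≡K → <⇒≱ N<K (≡.subst (_≤ N) b≡K b≤N)))

  partitionSum-< : ∀ {r K} d → K < r → partitionSum (d + r) r K ≈ 0#
  partitionSum-< {r} {K} zero K<r =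
    sumBy-zero (rgsAll r) (All.zipWith (λ {p} → vanish {p}) (rgsAll-length r , rgsAll-allDistinct r))
    where
    vanish : ∀ {p} →
             length (proj₁ p) ≡ r × (T (allDistinct (word p)) → nblocks p ≡ r × word p ≡ upTo r) →
             pointMass (nblocks p) (prefixWeight r p) K ≈ 0#
    vanish {p} (|p|≡r , distinct⇒) with distinctPrefix r p in eq
    ... | false = reflexive (pointMass-0# (nblocks p) K)
    ... | true  = reflexive (pointMass-≢ _ (λ b≡K →
                    <⇒≢ K<r (≡.trans (≡.sym b≡K) (proj₁ (distinct⇒ word-distinct)))))
      where
      word-distinct : T (allDistinct (word p))
      word-distinct = ≡.subst (T ∘ allDistinct)
        (take-all r (word p) (≤-reflexive (≡.trans (length-reverse (proj₁ p)) |p|≡r)))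
        (≡.subst T (≡.sym eq) _)
  partitionSum-< {r} {K} (suc d) K<r =
    trans (partitionSum-suc {d + r} (m≤n+m r d) K)
          (qStirlingStep-vanishes r (λ K′ K′<r → partitionSum-< d K′<r) K K<r)

  Sq-suc : ∀ i l → Sq q (suc i) l ≈ qStirlingStep (Sq q i) l
  Sq-suc i l = trans (Sq≈partitionSum (suc i) l)
    (trans (partitionSum-suc {i} z≤n l) (qStirlingStep-cong (λ l → sym (Sq≈partitionSum i l)) l))

  Sq-> : ∀ {i l} → i < l → Sq q i l ≈ 0#
  Sq-> {i} {l} i<l = trans (Sq≈partitionSum i l) (partitionSum-> 0 i<l)

  Sq-zero : ∀ l → Sq q 0 l ≈ pointMass 0 1# l
  Sq-zero zero    = +-identityʳ 1#
  Sq-zero (suc l) = refl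

  binomialTransform : ℕ → ℕ → (ℕ → Carrier) → Carrier
  binomialTransform s = binomialSum (qint q s) (q ^ s)

  -- Weight of adding n elements to a partition with s blocks so that l new blocks appear:
  -- n - i of them join old blocks (factor [s]_q each), the other i form a partition with l
  -- blocks, all of whose indices exceed the s old ones (factor q^s each).
  kernel : ℕ → ℕ → ℕ → Carrier
  kernel s n l = binomialTransform s n (λ i → Sq q i l)

  kernel-zero : ∀ s l → kernel s 0 l ≈ pointMass 0 1# l
  kernel-zero s l = trans (binomialSum-zero (qint q s) (q ^ s) (λ i → Sq q i l)) (Sq-zero l)

  openBlock-binomialSum : ∀ x y n (f : ℕ → ℕ → Carrier) l →
    binomialSum x y n (λ i → openBlock (f i) l) ≈ openBlock (λ l → binomialSum x y n (λ i → f i l)) l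
  openBlock-binomialSum x y n f zero    = binomialSum-0# x y n
  openBlock-binomialSum x y n f (suc l) = binomialSum-*ˡ x y n (q ^ l) (λ i → f i l)

  kernel-suc : ∀ s n l →
    kernel s (suc n) l ≈ qint q (s + l) ⊗ kernel s n l ⊕ q ^ s ⊗ openBlock (kernel s n) l
  kernel-suc s n l = begin
    kernel s (suc n) l
      ≈⟨ binomialSum-suc x y n (λ i → Sq q i l) ⟩
    x ⊗ kernel s n l ⊕ y ⊗ binomialSum x y n (λ i → Sq q (suc i) l)
      ≈⟨ +-congˡ (*-congˡ (binomialSum-cong< x y n (λ i _ → Sq-suc i l))) ⟩
    x ⊗ kernel s n l ⊕ y ⊗ binomialSum x y n (λ i → qint q l ⊗ Sq q i l ⊕ openBlock (Sq q i) l)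
      ≈⟨ +-congˡ (*-congˡ (trans (binomialSum-+ x y n (λ i → qint q l ⊗ Sq q i l)
                                                      (λ i → openBlock (Sq q i) l))
                                 (+-cong (binomialSum-*ˡ x y n (qint q l) (λ i → Sq q i l))
                                         (openBlock-binomialSum x y n (Sq q) l)))) ⟩
    x ⊗ kernel s n l ⊕ y ⊗ (qint q l ⊗ kernel s n l ⊕ openBlock (kernel s n) l)
      ≈⟨ solve 5 (λ X Y Qˡ Kˡ O → X :* Kˡ :+ Y :* (Qˡ :* Kˡ :+ O)
                                  := (X :+ Y :* Qˡ) :* Kˡ :+ Y :* O)
           refl x y (qint q l) (kernel s n l) (openBlock (kernel s n) l) ⟩
    (x ⊕ y ⊗ qint q l) ⊗ kernel s n l ⊕ y ⊗ openBlock (kernel s n) l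
      ≈⟨ +-congʳ (*-congʳ (sym (qint-+ s l))) ⟩
    qint q (s + l) ⊗ kernel s n l ⊕ q ^ s ⊗ openBlock (kernel s n) l ∎
    where
    x y : Carrier
    x = qint q s
    y = q ^ s

  -- SqDiff q i k j is definitionally shifted j (Sq q i) k.
  shifted : ℕ → (ℕ → Carrier) → ℕ → Carrier
  shifted j f k = if j ≤ᵇ k then f (k ∸ j) else 0#

  shifted-suc : ∀ j f k → shifted (suc j) f (suc k) ≡ shifted j f k
  shifted-suc zero    f k = ≡.refl
  shifted-suc (suc j) f k = ≡.refl

  shifted-+ : ∀ j f l → shifted j f (j + l) ≡ f l
  shifted-+ zero    f l = ≡.refl
  shifted-+ (suc j) f l = ≡.trans (shifted-suc j f (j + l)) (shifted-+ j f l)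

  shifted-< : ∀ {j k} f → k < j → shifted j f k ≡ 0#
  shifted-< {suc j} {zero}  f _         = ≡.refl
  shifted-< {suc j} {suc k} f (s≤s k<j) = ≡.trans (shifted-suc j f k) (shifted-< f k<j)

  shifted-+-+ : ∀ r j f k → shifted (r + j) f (r + k) ≡ shifted j f k
  shifted-+-+ zero    j f k = ≡.refl
  shifted-+-+ (suc r) j f k = ≡.trans (shifted-suc (r + j) f (r + k)) (shifted-+-+ r j f k)

  shifted-cong : ∀ j {f g} → (∀ l → f l ≈ g l) → ∀ k → shifted j f k ≈ shifted j g k
  shifted-cong j f≈g k with j ≤ᵇ k
  ... | true  = f≈g (k ∸ j)
  ... | false = refl

  shifted-pointMass : ∀ j x k → shifted j (pointMass 0 x) k ≡ pointMass j x k
  shifted-pointMass zero    x k       = ≡.refl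
  shifted-pointMass (suc j) x zero    = ≡.refl
  shifted-pointMass (suc j) x (suc k) = ≡.trans (shifted-suc j (pointMass 0 x) k) (shifted-pointMass j x k)

  shifted-binomialSum : ∀ x y n j (f : ℕ → ℕ → Carrier) k →
    shifted j (λ l → binomialSum x y n (λ i → f i l)) k ≈ binomialSum x y n (λ i → shifted j (f i) k)
  shifted-binomialSum x y n j f k with j ≤ᵇ k
  ... | true  = refl
  ... | false = sym (binomialSum-0# x y n)

  openBlock-shifted : ∀ s f l → openBlock (shifted s f) (s + l) ≈ q ^ s ⊗ openBlock f l
  openBlock-shifted zero    f zero    = sym (zeroʳ _)
  openBlock-shifted (suc s) f zero    =
    trans (*-congˡ (reflexive (shifted-< f (s≤s (≤-reflexive (ℕ.+-identityʳ s))))))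
          (trans (zeroʳ _) (sym (zeroʳ _)))
  openBlock-shifted s       f (suc l) rewrite +-suc s l =
    trans (*-congˡ (reflexive (shifted-+ s f l))) (trans (*-congʳ (^-homo-* q s l)) (*-assoc _ _ _))

  kernel-solves : ∀ s → Solves (λ n → shifted s (kernel s n))
  kernel-solves s n K with s ≤? K
  ... | no s≰K = trans (reflexive (shifted-< (kernel s (suc n)) K<s))
    (sym (qStirlingStep-vanishes s (λ K′ K′<s → reflexive (shifted-< (kernel s n) K′<s)) K K<s))
    where K<s = ≰⇒> s≰K
  ... | yes s≤K with l , ≡.refl ← m≤n⇒∃[o]m+o≡n s≤K = begin
    shifted s (kernel s (suc n)) (s + l)  ≡⟨ shifted-+ s (kernel s (suc n)) l ⟩
    kernel s (suc n) l                    ≈⟨ kernel-suc s n l ⟩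
    qint q (s + l) ⊗ kernel s n l ⊕ q ^ s ⊗ openBlock (kernel s n) l
      ≈⟨ sym (+-cong (*-congˡ (reflexive (shifted-+ s (kernel s n) l)))
                     (openBlock-shifted s (kernel s n) l)) ⟩
    qStirlingStep (shifted s (kernel s n)) (s + l) ∎

  partitionSum-expansion : ∀ {N r} → r ≤ N → ∀ n K →
    partitionSum (n + N) r K ≈ Σ (suc N) (λ J → partitionSum N r J ⊗ shifted J (kernel J n) K)
  partitionSum-expansion {N} {r} r≤N =
    solutions-unique {F = λ n K → partitionSum (n + N) r K}
      (λ n → partitionSum-suc {n + N} (≤-trans r≤N (m≤n+m N n)))
      (Solves-Σ (suc N) (partitionSum N r) kernel-solves)
      initial
    where
    initial : ∀ K →
      partitionSum N r K ≈ Σ (suc N) (λ J → partitionSum N r J ⊗ shifted J (kernel J 0) K)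
    initial K = sym (begin
      Σ (suc N) (λ J → partitionSum N r J ⊗ shifted J (kernel J 0) K)
        ≈⟨ Σ-cong (suc N) (λ J → *-congˡ {partitionSum N r J}
             (trans (shifted-cong J (kernel-zero J) K) (reflexive (shifted-pointMass J 1# K)))) ⟩
      Σ (suc N) (λ J → partitionSum N r J ⊗ pointMass J 1# K)
        ≈⟨ select ⟩
      partitionSum N r K ∎)
      where
      select : Σ (suc N) (λ J → partitionSum N r J ⊗ pointMass J 1# K) ≈ partitionSum N r K
      select with K <? suc N
      ... | yes K<1+N = Σ-pointMass (suc N) K (partitionSum N r) K<1+N
      ... | no  K≮1+N = trans (Σ-pointMass-≥ (suc N) K (partitionSum N r) (≮⇒≥ K≮1+N))
                              (sym (partitionSum-> r (≮⇒≥ K≮1+N)))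

  Sqr-expansion : ∀ m n r k → Sqr q r (m + n) k ≈
    Σ (suc m) (λ j → Sqr q r m j ⊗ binomialTransform (j + r) n (λ i → SqDiff q i k j))
  Sqr-expansion m n r k = begin
    Sqr q r (m + n) k
      ≈⟨ Sqr≈partitionSum r (m + n) k ⟩
    partitionSum (m + n + r) r (k + r)
      ≡⟨ ≡.cong₂ (λ N K → partitionSum N r K) (reassociate m n r) (ℕ.+-comm k r) ⟩
    partitionSum (n + (m + r)) r (r + k)
      ≈⟨ partitionSum-expansion (m≤n+m r m) n (r + k) ⟩
    Σ (suc (m + r)) f
      ≡⟨ ≡.cong (λ L → Σ L f) (≡.trans (≡.cong suc (ℕ.+-comm m r)) (≡.sym (+-suc r m))) ⟩
    Σ (r + suc m) f
      ≈⟨ Σ-split r (suc m) f ⟩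
    Σ r f ⊕ Σ (suc m) (λ j → f (r + j))
      ≈⟨ +-cong (Σ-zero r (λ J J<r → trans (*-congʳ (partitionSum-< m J<r)) (zeroˡ _)))
                (Σ-cong (suc m) term) ⟩
    0# ⊕ Σ (suc m) (λ j → Sqr q r m j ⊗ binomialTransform (j + r) n (λ i → SqDiff q i k j))
      ≈⟨ +-identityˡ _ ⟩
    Σ (suc m) (λ j → Sqr q r m j ⊗ binomialTransform (j + r) n (λ i → SqDiff q i k j)) ∎
    where
    f : ℕ → Carrier
    f J = partitionSum (m + r) r J ⊗ shifted J (kernel J n) (r + k)
    reassociate : ∀ m n r → m + n + r ≡ n + (m + r)
    reassociate m n r = ≡.trans (ℕ.+-assoc m n r) (≡.trans (≡.cong (m +_) (ℕ.+-comm n r))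
                      (≡.trans (≡.sym (ℕ.+-assoc m r n)) (ℕ.+-comm (m + r) n)))
    term : ∀ j → f (r + j) ≈ Sqr q r m j ⊗ binomialTransform (j + r) n (λ i → SqDiff q i k j)
    term j = *-cong
      (trans (reflexive (≡.cong (partitionSum (m + r) r) (ℕ.+-comm r j))) (sym (Sqr≈partitionSum r m j)))
      (trans (reflexive (≡.trans (shifted-+-+ r j (kernel (r + j) n) k)
                                 (≡.cong (λ s → shifted j (kernel s n) k) (ℕ.+-comm r j))))
             (shifted-binomialSum (qint q (j + r)) (q ^ (j + r)) n j (Sq q) k))

  Σ-shifted : ∀ j i L {f} → j + suc i ≤ L → (∀ l → i < l → f l ≈ 0#) →
    Σ L (shifted j f) ≈ Σ (suc i) f
  Σ-shifted j i L {f} j+i<L f≈0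
    with L′ , ≡.refl ← m≤n⇒∃[o]m+o≡n (≤-trans (m≤m+n j (suc i)) j+i<L) = begin
    Σ (j + L′) (shifted j f)                             ≈⟨ Σ-split j L′ (shifted j f) ⟩
    Σ j (shifted j f) ⊕ Σ L′ (λ l → shifted j f (j + l))
      ≈⟨ +-cong (Σ-zero j (λ k k<j → reflexive (shifted-< f k<j)))
                (Σ-cong L′ (λ l → reflexive (shifted-+ j f l))) ⟩
    0# ⊕ Σ L′ f                                          ≈⟨ +-identityˡ _ ⟩
    Σ L′ f                                               ≈⟨ Σ-truncate (ℕ.+-cancelˡ-≤ j _ _ j+i<L) f≈0 ⟩
    Σ (suc i) f                                          ∎

  Σ-SqDiff : ∀ {m n i j} → i ≤ n → j ≤ m → Σ (suc (m + n)) (λ k → SqDiff q i k j) ≈ Bq q i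
  Σ-SqDiff {m} {n} {i} {j} i≤n j≤m =
    trans (Σ-shifted j i (suc (m + n)) bound (λ l i<l → Sq-> i<l))
          (reflexive (≡.sym (sumTo≡Σ i (Sq q i))))
    where
    bound : j + suc i ≤ suc (m + n)
    bound = ≡.subst (_≤ suc (m + n)) (≡.sym (+-suc j i)) (s≤s (ℕ.+-mono-≤ j≤m i≤n))

  Bqr-expansion : ∀ m n r → Bqr q r (m + n) ≈
    Σ (suc m) (λ j → Sqr q r m j ⊗ binomialTransform (j + r) n (Bq q))
  Bqr-expansion m n r = begin
    Bqr q r (m + n)                                            ≡⟨ sumTo≡Σ (m + n) (Sqr q r (m + n)) ⟩
    Σ (suc (m + n)) (Sqr q r (m + n))                          ≈⟨ Σ-cong (suc (m + n)) (Sqr-expansion m n r) ⟩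
    Σ (suc (m + n)) (λ k → Σ (suc m) (λ j → term j (SqDiffs k j)))
      ≈⟨ Σ-swap (suc (m + n)) (suc m) (λ k j → term j (SqDiffs k j)) ⟩
    Σ (suc m) (λ j → Σ (suc (m + n)) (λ k → term j (SqDiffs k j)))
      ≈⟨ Σ-cong< (suc m) (λ j j<1+m → collapse j (≤-pred j<1+m)) ⟩
    Σ (suc m) (λ j → term j (Bq q))                            ∎
    where
    term : ℕ → (ℕ → Carrier) → Carrier
    term j u = Sqr q r m j ⊗ binomialTransform (j + r) n u
    SqDiffs : ℕ → ℕ → ℕ → Carrier
    SqDiffs k j i = SqDiff q i k j
    collapse : ∀ j → j ≤ m → Σ (suc (m + n)) (λ k → term j (SqDiffs k j)) ≈ term j (Bq q)
    collapse j j≤m = begin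
      Σ (suc (m + n)) (λ k → term j (SqDiffs k j))
        ≈⟨ sym (Σ-distribˡ (suc (m + n)) (Sqr q r m j) (λ k → binomialTransform (j + r) n (SqDiffs k j))) ⟩
      Sqr q r m j ⊗ Σ (suc (m + n)) (λ k → binomialTransform (j + r) n (SqDiffs k j))
        ≈⟨ *-congˡ (sym (binomialSum-Σ x y n (suc (m + n)) (λ k → SqDiffs k j))) ⟩
      term j (λ i → Σ (suc (m + n)) (λ k → SqDiff q i k j))
        ≈⟨ *-congˡ (binomialSum-cong< x y n (λ i i≤n → Σ-SqDiff i≤n j≤m)) ⟩
      term j (Bq q) ∎
      where
      x y : Carrier
      x = qint q (j + r)
      y = q ^ (j + r)

  binomialTransforms-as-doubleSum : ∀ m n r (X : ℕ → ℕ → Carrier) →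
    Σ (suc m) (λ j → Sqr q r m j ⊗ binomialTransform (j + r) n (X j)) ≈
    sumTo n (λ i → sumTo m (λ j →
      q ^ (i * (j + r)) ⊗ qint q (j + r) ^ (n ∸ i) ⊗ ((n C i) · (Sqr q r m j ⊗ X j i))))
  binomialTransforms-as-doubleSum m n r X = begin
    Σ (suc m) (λ j → Sqr q r m j ⊗ binomialTransform (j + r) n (X j))
      ≈⟨ Σ-cong (suc m) expand ⟩
    Σ (suc m) (λ j → Σ (suc n) (λ i → term i j))
      ≈⟨ Σ-swap (suc m) (suc n) (λ j i → term i j) ⟩
    Σ (suc n) (λ i → Σ (suc m) (term i))
      ≈⟨ sym (Σ-cong (suc n) (λ i → reflexive (sumTo≡Σ m (term i)))) ⟩
    Σ (suc n) (λ i → sumTo m (term i))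
      ≡⟨ ≡.sym (sumTo≡Σ n (λ i → sumTo m (term i))) ⟩
    sumTo n (λ i → sumTo m (term i)) ∎
    where
    term : ℕ → ℕ → Carrier
    term i j = q ^ (i * (j + r)) ⊗ qint q (j + r) ^ (n ∸ i) ⊗ ((n C i) · (Sqr q r m j ⊗ X j i))
    power : ∀ i j → (q ^ (j + r)) ^ i ≈ q ^ (i * (j + r))
    power i j = trans (^-assocʳ q (j + r) i) (reflexive (≡.cong (q ^_) (ℕ.*-comm (j + r) i)))
    expand : ∀ j → Sqr q r m j ⊗ binomialTransform (j + r) n (X j) ≈ Σ (suc n) (λ i → term i j)
    expand j = trans (sym (binomialSum-*ˡ (qint q (j + r)) (q ^ (j + r)) n (Sqr q r m j) (X j)))
                     (Σ-cong (suc n) {g = λ i → term i j} (λ i → *-congʳ (*-congʳ (power i j))))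

theorem2p1 : {c ℓ : Level} (R : CommutativeSemiring c ℓ) →
    let open QStirling R in
    (q : Carr) (m n r k : ℕ) →
      (Sqr q r (m + n) k ≈ᴿ sumTo n (λ i → sumTo m (λ j →
         (q ^ᴿ (i * (j + r))) ⊗ (qint q (j + r) ^ᴿ (n ∸ i)) ⊗ ((n C i) ·ᴿ (Sqr q r m j ⊗ SqDiff q i k j)))))
      × (Bqr q r (m + n) ≈ᴿ sumTo n (λ i → sumTo m (λ j →
         (q ^ᴿ (i * (j + r))) ⊗ (qint q (j + r) ^ᴿ (n ∸ i)) ⊗ ((n C i) ·ᴿ (Sqr q r m j ⊗ Bq q i)))))
theorem2p1 R q m n r k =
  trans (Sqr-expansion m n r k) (binomialTransforms-as-doubleSum m n r (λ j i → SqDiff q i k j)) ,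
  trans (Bqr-expansion m n r) (binomialTransforms-as-doubleSum m n r (λ j i → Bq q i))
  where
  open CommutativeSemiring R using (trans)
  open QStirling R using (SqDiff; Bq)
  open QStirlingRecurrence R q
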